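{- For every integer $n\geq 1$, the number of absolutely symmetric rooted trees with $n$ edges (counted up to isomorphism of rooted trees) equals $T(n)$.
   Context: For a vector $A=(a_1,\ldots,a_k)$, $k\geq 1$, of positive integers define $f(A)$ recursively by $f(a_1)=a_1$ and $f(a_1,\ldots,a_{i+1})=(f(a_1,\ldots,a_i)+1)\,a_{i+1}$. For a positive integer $n$, the complexity $T(n)$ is the number of vectors $A$ (of any length $k\geq1$, with positive integer entries) such that $f(A)=n$. A rooted tree is called absolutely symmetric if it has exactly one plane (flat) realization, i.e. there is no plane rooted tree isomorphic to it (as a rooted tree) that is distinct from it as a plane rooted tree; equivalently, for every vertex $v$, the subtrees rooted at the children of $v$ are pairwise isomorphic as rooted trees. -}

module Defs where

open import Data.Nat using (ℕ; zero; suc; _+_; _*_; _≤_)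
open import Data.List using (List; []; _∷_; length)
open import Data.List.NonEmpty using (List⁺; _∷_; toList)
open import Data.List.Relation.Unary.All using (All)
open import Data.List.Relation.Unary.Any using (Any)
open import Data.List.Relation.Unary.AllPairs using (AllPairs)
open import Data.List.Relation.Binary.Pointwise using (Pointwise)
open import Data.List.Relation.Binary.Permutation.Propositional using (_↭_)
open import Data.Product using (_×_)
open import Relation.Nullary using (¬_)
open import Relation.Binary.PropositionalEquality using (_≡_)

-- The function f on vectors A = (a₁,…,a_k), k ≥ 1.
-- fFrom acc [a_{i+1},…] continues the recursion from the value acc = f(a₁,…,a_i).

fFrom : ℕ → List ℕ → ℕ
fFrom acc []       = acc
fFrom acc (a ∷ as) = fFrom ((acc + 1) * a) as

f : List⁺ ℕ → ℕ
f (a ∷ as) = fFrom a as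

IsTVector : ℕ → List⁺ ℕ → Set
IsTVector n A = All (1 ≤_) (toList A) × f A ≡ n

-- Counting: "Count _≈_ P k" says that the objects satisfying P, taken up to
-- the equivalence _≈_, number exactly k: there is a list of k pairwise
-- non-equivalent objects satisfying P such that every object satisfying P
-- is equivalent to one of them.

record Count {A : Set} (_≈_ : A → A → Set) (P : A → Set) (k : ℕ) : Set where
  field
    items    : List A
    size     : length items ≡ k
    sound    : All P items
    complete : ∀ a → P a → Any (a ≈_) items
    distinct : AllPairs (λ x y → ¬ (x ≈ y)) items

TEquals : ℕ → ℕ → Set
TEquals n k = Count _≡_ (IsTVector n) k

data PlaneTree : Set where
  node : List PlaneTree → PlaneTree

data _≅_ : PlaneTree → PlaneTree → Set where
  node : ∀ {ts vs us} → Pointwise _≅_ ts vs → vs ↭ us → node ts ≅ node us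

mutual
  edges : PlaneTree → ℕ
  edges (node ts) = edgesList ts

  edgesList : List PlaneTree → ℕ
  edgesList []       = 0
  edgesList (t ∷ ts) = suc (edges t) + edgesList ts

-- Absolutely symmetric: the rooted tree has exactly one plane realization,
-- i.e. every plane tree isomorphic to it is equal to it as a plane tree.
AbsolutelySymmetric : PlaneTree → Set
AbsolutelySymmetric t = ∀ u → u ≅ t → u ≡ t

AbsSymWithEdges : ℕ → PlaneTree → Set
AbsSymWithEdges n t = AbsolutelySymmetric t × edges t ≡ n

module Submission where

-- The vectors A counted by T(n) correspond bijectively to the absolutely
-- symmetric trees with n edges.  Reading A = (a₁,…,a_k) from the left,
-- tree A starts from a single vertex and, at step i, hangs a_i copies of
-- the tree built so far below a new root.  Grafting a copies of a tree with
-- e edges gives (e + 1)·a edges, the recursion of f, so tree A has f(A) edges.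
--
-- Bounding the length and the entries of
-- a vector by f(A) then shows that T(n) is well defined.  For trees:
-- trees of vectors are absolutely symmetric; an absolutely symmetric tree has
-- identical children at the root, so it is rebuilt from the list `decode`
-- of children numbers along a branch; and `decode` inverts `tree`.

open import Defs
open import Data.Nat using (ℕ; zero; suc; _+_; _*_; _≤_; _≤?_; _≟_; z≤n; s≤s)
open import Data.Nat.Properties
  using (n≮0; ≤-reflexive; ≤-trans; module ≤-Reasoning; +-suc; +-comm; +-identityʳ;
         *-identityˡ; *-comm; m≤m+n; m≤n+m; m≤m*n; +-monoˡ-≤)
open import Data.List using (List; []; _∷_; _++_; _∷ʳ_; length; map; replicate; foldl;
                             upTo; filter; deduplicate; cartesianProductWith)
open import Data.List.NonEmpty using (List⁺; _∷_; toList)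
open import Data.List.Properties
  using (≡-dec; ++-assoc; ++-identityʳ; length-map; length-replicate; foldl-∷ʳ; ∷-injectiveˡ)
open import Data.List.Membership.Propositional using (_∈_)
open import Data.List.Membership.Propositional.Properties
  using (∈-filter⁺; ∈-deduplicate⁺; ∈-upTo⁺; ∈-cartesianProductWith⁺; ∈-∃++)
open import Data.List.Relation.Unary.All using (All; []; _∷_; all?)
import Data.List.Relation.Unary.All as All
import Data.List.Relation.Unary.All.Properties as AllP
open import Data.List.Relation.Unary.Any using (Any; here; there)
import Data.List.Relation.Unary.Any as Any
import Data.List.Relation.Unary.Any.Properties as AnyP
open import Data.List.Relation.Unary.AllPairs using (AllPairs; []; _∷_)
import Data.List.Relation.Unary.AllPairs.Properties as AllPairsP
import Data.List.Relation.Unary.Unique.DecPropositional.Properties as UniqueP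
open import Data.List.Relation.Binary.Pointwise using (Pointwise; []; _∷_)
open import Data.List.Relation.Binary.Permutation.Propositional using (_↭_; ↭-refl; ↭-sym)
open import Data.List.Relation.Binary.Permutation.Propositional.Properties
  using (↭-length; ↭-empty-inv; All-resp-↭; shift)
open import Data.Product using (Σ; _×_; _,_; proj₁; proj₂)
open import Data.Empty using (⊥-elim)
open import Relation.Nullary using (¬_)
open import Relation.Nullary.Decidable using (_×-dec_; map′)
open import Relation.Unary using (Decidable)
open import Relation.Binary.Definitions using (DecidableEquality)
open import Relation.Binary.PropositionalEquality
  using (_≡_; _≢_; refl; sym; trans; cong; cong₂; subst; module ≡-Reasoning)

Count-transfer : ∀ {A B : Set} {P : A → Set} {Q : B → Set} {_≈_ : B → B → Set} {k : ℕ}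
  (g : A → B)
  → (∀ {a} → P a → Q (g a))
  → (∀ b → Q b → Σ A (λ a → P a × b ≈ g a))
  → (∀ {a a′} → P a → P a′ → g a ≈ g a′ → a ≡ a′)
  → Count _≡_ P k → Count _≈_ Q k
Count-transfer {P = P} {Q = Q} {_≈_ = _≈_} g preserves covers separates c = record
  { items    = map g items
  ; size     = trans (length-map g items) size
  ; sound    = AllP.map⁺ (All.map preserves sound)
  ; complete = complete′
  ; distinct = AllPairsP.map⁺ (apart sound distinct)
  }
  where
  open Count c

  complete′ : ∀ b → Q b → Any (b ≈_) (map g items)
  complete′ b qb with covers b qb
  ... | a , pa , b≈ga = AnyP.map⁺ (Any.map (λ { refl → b≈ga }) (complete a pa))

  apart : ∀ {xs} → All P xs → AllPairs _≢_ xs → AllPairs (λ x y → ¬ g x ≈ g y) xs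
  apart [] [] = []
  apart (px ∷ pxs) (x≢xs ∷ rest) =
    All.zipWith (λ { (x≢y , py) gx≈gy → x≢y (separates px py gx≈gy) }) (x≢xs , pxs)
    ∷ apart pxs rest

Count-fromCover : ∀ {A : Set} {P : A → Set} → DecidableEquality A → Decidable P
  → (xs : List A) → (∀ a → P a → a ∈ xs) → Σ ℕ (Count _≡_ P)
Count-fromCover {A} {P} _≟ₐ_ P? xs covers = length items , record
  { items    = items
  ; size     = refl
  ; sound    = AllP.deduplicate⁺ _≟ₐ_ (AllP.all-filter P? xs)
  ; complete = λ a pa → ∈-deduplicate⁺ _≟ₐ_ (∈-filter⁺ P? (covers a pa) pa)
  ; distinct = UniqueP.deduplicate-! _≟ₐ_ (filter P? xs)
  }
  where
  items : List A
  items = deduplicate _≟ₐ_ (filter P? xs)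

boundedLists : ℕ → ℕ → List (List ℕ)
boundedLists M zero    = [] ∷ []
boundedLists M (suc L) = [] ∷ cartesianProductWith _∷_ (upTo (suc M)) (boundedLists M L)

∈-boundedLists : ∀ {M} L xs → All (_≤ M) xs → length xs ≤ L → xs ∈ boundedLists M L
∈-boundedLists zero    []       _          _            = here refl
∈-boundedLists (suc L) []       _          _            = here refl
∈-boundedLists (suc L) (x ∷ xs) (x≤M ∷ ps) (s≤s len≤L) =
  there (∈-cartesianProductWith⁺ _∷_ (∈-upTo⁺ (s≤s x≤M)) (∈-boundedLists L xs ps len≤L))

step-bounds : ∀ acc b → 1 ≤ b → suc acc ≤ (acc + 1) * b × b ≤ (acc + 1) * b
step-bounds acc (suc b) _ rewrite +-comm acc 1 = m≤m*n (suc acc) (suc b) , m≤m+n (suc b) (acc * suc b)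

fFrom-growth : ∀ acc as → All (1 ≤_) as → acc + length as ≤ fFrom acc as
fFrom-growth acc []       []         = ≤-reflexive (+-identityʳ acc)
fFrom-growth acc (b ∷ bs) (1≤b ∷ ps) = begin
  acc + suc (length bs)        ≡⟨ +-suc acc (length bs) ⟩
  suc acc + length bs          ≤⟨ +-monoˡ-≤ (length bs) (proj₁ (step-bounds acc b 1≤b)) ⟩
  (acc + 1) * b + length bs    ≤⟨ fFrom-growth ((acc + 1) * b) bs ps ⟩
  fFrom ((acc + 1) * b) bs     ∎
  where open ≤-Reasoning

fFrom-entries : ∀ acc as → All (1 ≤_) as → All (_≤ fFrom acc as) as
fFrom-entries acc []       []         = []
fFrom-entries acc (b ∷ bs) (1≤b ∷ ps) =
  ≤-trans (proj₂ (step-bounds acc b 1≤b))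
          (≤-trans (m≤m+n _ (length bs)) (fFrom-growth ((acc + 1) * b) bs ps))
  ∷ fFrom-entries ((acc + 1) * b) bs ps

-- Every vector counted by T(n) has length at most n + 1 and entries at most n,
-- so it occurs among the following candidates.
candidates : ℕ → List (List⁺ ℕ)
candidates n = cartesianProductWith _∷_ (upTo (suc n)) (boundedLists n n)

candidates-complete : ∀ n A → IsTVector n A → A ∈ candidates n
candidates-complete .(fFrom a as) (a ∷ as) (1≤a ∷ ps , refl) =
  ∈-cartesianProductWith⁺ _∷_ (∈-upTo⁺ (s≤s a≤n)) (∈-boundedLists n as (fFrom-entries a as ps) len≤n)
  where
  n : ℕ
  n = fFrom a as
  a≤n : a ≤ n
  a≤n = ≤-trans (m≤m+n a (length as)) (fFrom-growth a as ps)
  len≤n : length as ≤ n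
  len≤n = ≤-trans (m≤n+m (length as) a) (fFrom-growth a as ps)

toList-injective : ∀ {X : Set} {A B : List⁺ X} → toList A ≡ toList B → A ≡ B
toList-injective {A = _ ∷ _} {B = _ ∷ _} refl = refl

_≟⁺_ : DecidableEquality (List⁺ ℕ)
A ≟⁺ B = map′ toList-injective (cong toList) (≡-dec _≟_ (toList A) (toList B))

isTVector? : ∀ n → Decidable (IsTVector n)
isTVector? n A = all? (1 ≤?_) (toList A) ×-dec (f A ≟ n)

T-count : ∀ n → Σ ℕ (TEquals n)
T-count n = Count-fromCover _≟⁺_ (isTVector? n) (candidates n) (candidates-complete n)

leaf : PlaneTree
leaf = node []

graft : PlaneTree → ℕ → PlaneTree
graft t a = node (replicate a t)

build : PlaneTree → List ℕ → PlaneTree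
build = foldl graft

tree : List⁺ ℕ → PlaneTree
tree A = build leaf (toList A)

edges-replicate : ∀ a t → edgesList (replicate a t) ≡ a * suc (edges t)
edges-replicate zero    t = refl
edges-replicate (suc a) t = cong (suc (edges t) +_) (edges-replicate a t)

edges-graft : ∀ t a → edges (graft t a) ≡ (edges t + 1) * a
edges-graft t a = trans (edges-replicate a t) (trans (*-comm a (suc (edges t))) (cong (_* a) (+-comm 1 (edges t))))

edges-build : ∀ t as → edges (build t as) ≡ fFrom (edges t) as
edges-build t []       = refl
edges-build t (a ∷ as) = trans (edges-build (graft t a) as) (cong (λ e → fFrom e as) (edges-graft t a))

edges-tree : ∀ A → edges (tree A) ≡ f A
edges-tree (a ∷ as) =
  trans (edges-build (graft leaf a) as) (cong (λ e → fFrom e as) (trans (edges-graft leaf a) (*-identityˡ a)))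

mutual
  ≅-refl : ∀ t → t ≅ t
  ≅-refl (node ts) = node (pointwise-refl ts) ↭-refl

  pointwise-refl : ∀ ts → Pointwise _≅_ ts ts
  pointwise-refl []       = []
  pointwise-refl (t ∷ ts) = ≅-refl t ∷ pointwise-refl ts

≅-reflexive : ∀ {t u} → t ≡ u → t ≅ u
≅-reflexive {t} refl = ≅-refl t

node-injective : ∀ {ts us : List PlaneTree} → node ts ≡ node us → ts ≡ us
node-injective refl = refl

all≡-replicate : ∀ {A : Set} {x : A} {xs} → All (_≡ x) xs → xs ≡ replicate (length xs) x
all≡-replicate []         = refl
all≡-replicate (refl ∷ ps) = cong (_ ∷_) (all≡-replicate ps)

leaf-absSym : AbsolutelySymmetric leaf
leaf-absSym (node us) (node us≅vs vs↭[]) with ↭-empty-inv vs↭[]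
leaf-absSym (node []) (node [] _) | refl = refl

-- Identical copies of an absolutely symmetric tree form an absolutely
-- symmetric tree: a tree isomorphic to it has children all isomorphic, hence
-- equal, to t, and as many of them.
graft-absSym : ∀ t a → AbsolutelySymmetric t → AbsolutelySymmetric (graft t a)
graft-absSym t a t-sym (node us) (node {vs = vs} us≅vs vs↭) = cong node (begin
  us                       ≡⟨ collapse us≅vs vs≡t ⟩
  vs                       ≡⟨ all≡-replicate vs≡t ⟩
  replicate (length vs) t  ≡⟨ cong (λ m → replicate m t) (trans (↭-length vs↭) (length-replicate a)) ⟩
  replicate a t            ∎)
  where
  open ≡-Reasoning
  vs≡t : All (_≡ t) vs
  vs≡t = All-resp-↭ (↭-sym vs↭) (AllP.replicate⁺ a refl)

  collapse : ∀ {us vs} → Pointwise _≅_ us vs → All (_≡ t) vs → us ≡ vs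
  collapse []            []           = refl
  collapse (u≅v ∷ us≅vs) (refl ∷ vs≡t) = cong₂ _∷_ (t-sym _ u≅v) (collapse us≅vs vs≡t)

build-absSym : ∀ t as → AbsolutelySymmetric t → AbsolutelySymmetric (build t as)
build-absSym t []       t-sym = t-sym
build-absSym t (a ∷ as) t-sym = build-absSym (graft t a) as (graft-absSym t a t-sym)

tree-absSym : ∀ A → AbsolutelySymmetric (tree A)
tree-absSym A = build-absSym leaf (toList A) leaf-absSym

-- In an absolutely symmetric tree all children of the root coincide, since
-- moving any child to the front is an isomorphism.
siblings-equal : ∀ {c cs} → AbsolutelySymmetric (node (c ∷ cs)) → All (_≡ c) cs
siblings-equal {c} {cs} sym-t = All.tabulate to-front
  where
  to-front : ∀ {z} → z ∈ cs → z ≡ c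
  to-front {z} z∈cs with ∈-∃++ z∈cs
  ... | pre , post , refl = ∷-injectiveˡ (node-injective (sym-t (node (z ∷ c ∷ pre ++ post))
          (node (pointwise-refl (z ∷ c ∷ pre ++ post)) (↭-sym (shift z (c ∷ pre) post)))))

first-child-absSym : ∀ {c cs} → AbsolutelySymmetric (node (c ∷ cs)) → AbsolutelySymmetric c
first-child-absSym {c} {cs} sym-t u u≅c =
  ∷-injectiveˡ (node-injective (sym-t (node (u ∷ cs)) (node (u≅c ∷ pointwise-refl cs) ↭-refl)))

-- The numbers of children along the leftmost path, read from the bottom up.
-- On trees of vectors this inverts tree.
decode : PlaneTree → List ℕ
decode (node [])       = []
decode (node (c ∷ cs)) = decode c ∷ʳ suc (length cs)

decode-positive : ∀ t → All (1 ≤_) (decode t)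
decode-positive (node [])       = []
decode-positive (node (c ∷ cs)) = AllP.∷ʳ⁺ (decode-positive c) (s≤s z≤n)

decode-graft : ∀ t a → 1 ≤ a → decode (graft t a) ≡ decode t ∷ʳ a
decode-graft t (suc a) _ = cong (λ m → decode t ∷ʳ suc m) (length-replicate a)

decode-build : ∀ t as → All (1 ≤_) as → decode (build t as) ≡ decode t ++ as
decode-build t []       []         = sym (++-identityʳ (decode t))
decode-build t (a ∷ as) (1≤a ∷ ps) = begin
  decode (build (graft t a) as)  ≡⟨ decode-build (graft t a) as ps ⟩
  decode (graft t a) ++ as       ≡⟨ cong (_++ as) (decode-graft t a 1≤a) ⟩
  (decode t ∷ʳ a) ++ as          ≡⟨ ++-assoc (decode t) (a ∷ []) as ⟩
  decode t ++ a ∷ as             ∎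
  where open ≡-Reasoning

tree-injective : ∀ {A B} → All (1 ≤_) (toList A) → All (1 ≤_) (toList B) → tree A ≡ tree B → A ≡ B
tree-injective {A} {B} posA posB tA≡tB = toList-injective (begin
  toList A           ≡⟨ sym (decode-build leaf (toList A) posA) ⟩
  decode (tree A)    ≡⟨ cong decode tA≡tB ⟩
  decode (tree B)    ≡⟨ decode-build leaf (toList B) posB ⟩
  toList B           ∎)
  where open ≡-Reasoning

absSym-reconstruct : ∀ t → AbsolutelySymmetric t → t ≡ build leaf (decode t)
absSym-reconstruct (node [])       _     = refl
absSym-reconstruct (node (c ∷ cs)) sym-t = begin
  node (c ∷ cs)                    ≡⟨ cong node (all≡-replicate (refl ∷ siblings-equal sym-t)) ⟩
  graft c m                        ≡⟨ cong (λ u → graft u m) (absSym-reconstruct c (first-child-absSym sym-t)) ⟩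
  graft (build leaf (decode c)) m  ≡⟨ sym (foldl-∷ʳ graft leaf m (decode c)) ⟩
  build leaf (decode c ∷ʳ m)       ∎
  where
  open ≡-Reasoning
  m : ℕ
  m = suc (length cs)

tree-covers : ∀ n → 1 ≤ n → ∀ t → AbsSymWithEdges n t → Σ (List⁺ ℕ) (λ A → IsTVector n A × t ≅ tree A)
tree-covers n 1≤n t (sym-t , edges≡n)
  with decode t | decode-positive t | absSym-reconstruct t sym-t
... | []     | _   | t≡leaf = ⊥-elim (n≮0 (subst (1 ≤_) (trans (sym edges≡n) (cong edges t≡leaf)) 1≤n))
... | a ∷ as | pos | t≡tA   =
  a ∷ as , (pos , trans (sym (edges-tree (a ∷ as))) (trans (cong edges (sym t≡tA)) edges≡n)) , ≅-reflexive t≡tA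

theorem1 : ∀ (n : ℕ) → 1 ≤ n →
    Σ ℕ (λ k → TEquals n k × Count _≅_ (AbsSymWithEdges n) k)
theorem1 n 1≤n = k , vectors , Count-transfer tree preserves (tree-covers n 1≤n) separates vectors
  where
  k : ℕ
  k = proj₁ (T-count n)

  vectors : TEquals n k
  vectors = proj₂ (T-count n)

  preserves : ∀ {A} → IsTVector n A → AbsSymWithEdges n (tree A)
  preserves {A} (_ , fA≡n) = tree-absSym A , trans (edges-tree A) fA≡n

  separates : ∀ {A B} → IsTVector n A → IsTVector n B → tree A ≅ tree B → A ≡ B
  separates {A} {B} (posA , _) (posB , _) tA≅tB = tree-injective posA posB (tree-absSym B (tree A) tA≅tB)
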